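{- Let $\Phi$ be a logic program. If $e:[\forall\underline{x}].\ \underline{A}\Rightarrow B$ is derivable given axioms $\Phi$ with $e$ in beta-normal form, then the transformed judgement $F(e:[\forall\underline{x}].\ \underline{A}\Rightarrow B)$ is derivable given axioms $F(\Phi)$.
   Context: Syntax: first-order terms $t ::= x \mid f(t_1,\dots,t_n)$; atomic formulas $P(t_1,\dots,t_n)$; Horn formulas $[\forall \underline{x}].\ A_1,\dots,A_n \Rightarrow A$ ($n\ge0$), $\forall\underline{x}$ quantifying all free term variables, $[\forall\underline{x}].F$ meaning $F$ or $\forall\underline{x}.F$. Proof terms $p,e ::= \kappa \mid a \mid \lambda a.e \mid e\ e'$; beta-reduction: congruence closure of $(\lambda a.p)p'\to[p'/a]p$. A logic program $\Phi$ is a list of closed Horn formulas labelled by distinct proof-term constants $\kappa$. Typing given $\Phi$: (axiom) $\kappa:\forall\underline{x}.F$ if $(\kappa:\forall\underline{x}.F)\in\Phi$; (gen) $e:F\ \Rightarrow\ e:\forall\underline{x}.F$; (inst) $e:\forall\underline{x}.F\ \Rightarrow\ e:[\underline{t}/\underline{x}]F$; (cut) from $e_1:\underline{A}\Rightarrow D$ and $e_2:\underline{B},D\Rightarrow C$ infer $\lambda\underline{a}.\lambda\underline{b}.(e_2\ \underline{b})(e_1\ \underline{a}):\underline{A},\underline{B}\Rightarrow C$ ($\underline{a},\underline{b}$ fresh proof-term variables of the lengths of $\underline{A},\underline{B}$). It is known that a typed normal proof term of $[\forall\underline{x}].A_1,\dots,A_m\Rightarrow B$ is either a constant $\kappa$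 or of the form $\lambda a_1\cdots\lambda a_m.n$ with $n$ first-order (built from proof variables and constants by application) and normal. Representation: for a map $\phi$ from proof-term variables to first-order terms, define on first-order normal proof terms $\llbracket a\rrbracket_\phi=\phi(a)$ and $\llbracket\kappa\ p_1\cdots p_n\rrbracket_\phi=f_\kappa(\llbracket p_1\rrbracket_\phi,\dots,\llbracket p_n\rrbracket_\phi)$, where $f_\kappa$ is a new function symbol associated with $\kappa$. For $A\equiv P(t_1,\dots,t_n)$ and a term $t'$ with free variables disjoint from those of the $t_i$, $A[t']$ denotes $P(t_1,\dots,t_n,t')$. Realizability transformation: $F(\kappa:\forall\underline{x}.A_1,\dots,A_m\Rightarrow B)=\kappa:\forall\underline{x}.\forall\underline{y}.A_1[y_1],\dots,A_m[y_m]\Rightarrow B[f_\kappa(y_1,\dots,y_m)]$, and $F(\lambda\underline{a}.n:[\forall\underline{x}].A_1,\dots,A_m\Rightarrow B)=\lambda\underline{a}.n:[\forall\underline{x}.\forall\underline{y}].A_1[y_1],\dots,A_m[y_m]\Rightarrow B[\llbracket n\rrbracket_{[\underline{y}/\underline{a}]}]$, where in both cases $y_1,\dots,y_m$ are fresh distinct term variables and $[\underline{y}/\underline{a}]$ maps $a_i$ to $y_i$. $F(\Phi)$ is obtained by applying $F$ to every axiom of $\Phi$. -}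

module Defs where

open import Data.Bool using (Bool; true; false; if_then_else_)
open import Data.Nat using (ℕ; zero; suc; _+_; _∸_; _⊔_; _<ᵇ_; _≡ᵇ_; pred)
open import Data.List using (List; []; _∷_; _++_; _∷ʳ_; map; length; zipWith; upTo; foldr; reverse; concatMap)
open import Data.Maybe using (Maybe; just; nothing; _>>=_)
open import Data.Sum using (_⊎_; inj₁; inj₂)
open import Data.Product using (_×_; _,_)
open import Data.List.Membership.Propositional using (_∈_)
open import Relation.Nullary using (¬_)

-- First-order syntax over a set of function symbols Fn.
-- Term variables and predicate symbols are natural numbers.

data Term (Fn : Set) : Set where
  var : ℕ → Term Fn
  fn  : Fn → List (Term Fn) → Term Fn

data Atom (Fn : Set) : Set where
  atom : ℕ → List (Term Fn) → Atom Fn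

-- Horn formula [∀x̲]. A₁,…,Aₙ ⇒ A.
-- 'quant = true' means the formula is prefixed by ∀x̲ binding ALL its
-- free term variables; 'quant = false' means the bare formula.
record Horn (Fn : Set) : Set where
  constructor ⟨_∣_⇒_⟩
  field
    quant : Bool
    hyps  : List (Atom Fn)
    head  : Atom Fn
open Horn public

-- A logic program: closed Horn formulas κ : ∀x̲. A̲ ⇒ B,
-- each labelled by a proof-term constant κ (a natural number).
record Clause (Fn : Set) : Set where
  constructor _∶_⇒_
  field
    label   : ℕ
    cHyps   : List (Atom Fn)
    cHead   : Atom Fn
open Clause public

Program : Set → Set
Program Fn = List (Clause Fn)

mutual
  substT : ∀ {Fn} → (ℕ → Term Fn) → Term Fn → Term Fn
  substT σ (var x)   = σ x
  substT σ (fn f ts) = fn f (substTs σ ts)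

  substTs : ∀ {Fn} → (ℕ → Term Fn) → List (Term Fn) → List (Term Fn)
  substTs σ []       = []
  substTs σ (t ∷ ts) = substT σ t ∷ substTs σ ts

substA : ∀ {Fn} → (ℕ → Term Fn) → Atom Fn → Atom Fn
substA σ (atom P ts) = atom P (substTs σ ts)

mutual
  varsT : ∀ {Fn} → Term Fn → List ℕ
  varsT (var x)   = x ∷ []
  varsT (fn f ts) = varsTs ts

  varsTs : ∀ {Fn} → List (Term Fn) → List ℕ
  varsTs []       = []
  varsTs (t ∷ ts) = varsT t ++ varsTs ts

varsA : ∀ {Fn} → Atom Fn → List ℕ
varsA (atom P ts) = varsTs ts

varsH : ∀ {Fn} → List (Atom Fn) → Atom Fn → List ℕ
varsH As B = concatMap varsA As ++ varsA B

mutual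
  mapT : ∀ {F G : Set} → (F → G) → Term F → Term G
  mapT g (var x)   = var x
  mapT g (fn f ts) = fn (g f) (mapTs g ts)

  mapTs : ∀ {F G : Set} → (F → G) → List (Term F) → List (Term G)
  mapTs g []       = []
  mapTs g (t ∷ ts) = mapT g t ∷ mapTs g ts

mapA : ∀ {F G : Set} → (F → G) → Atom F → Atom G
mapA g (atom P ts) = atom P (mapTs g ts)

-- Proof terms (de Bruijn indices for proof-term variables)
--   con κ : constant,  pv i : variable,  lam e : λa.e,  app e e' : e e'

data PT : Set where
  con : ℕ → PT
  pv  : ℕ → PT
  lam : PT → PT
  app : PT → PT → PT

shift : ℕ → ℕ → PT → PT
shift c d (con k)   = con k
shift c d (pv x)    = if x <ᵇ c then pv x else pv (x + d)
shift c d (lam e)   = lam (shift (suc c) d e)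
shift c d (app e f) = app (shift c d e) (shift c d f)

-- capture-avoiding substitution of s for variable j, lowering variables > j
-- (the binder of j is being removed)
sub : ℕ → PT → PT → PT
sub j s (con k)   = con k
sub j s (pv x)    = if x <ᵇ j then pv x else (if x ≡ᵇ j then s else pv (pred x))
sub j s (lam e)   = lam (sub (suc j) (shift 0 1 s) e)
sub j s (app e f) = app (sub j s e) (sub j s f)

data _⟶β_ : PT → PT → Set where
  β    : ∀ {p p'} → app (lam p) p' ⟶β sub 0 p' p
  ξlam : ∀ {e e'} → e ⟶β e' → lam e ⟶β lam e'
  ξl   : ∀ {e e' f} → e ⟶β e' → app e f ⟶β app e' f
  ξr   : ∀ {e f f'} → f ⟶β f' → app e f ⟶β app e f'

Normal : PT → Set
Normal e = ∀ e' → ¬ (e ⟶β e')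

lams : ℕ → PT → PT
lams zero    e = e
lams (suc n) e = lam (lams n e)

apps : PT → List PT → PT
apps e []       = e
apps e (p ∷ ps) = apps (app e p) ps

-- λa₁…λaₙ.λb₁…λbₘ.(e₂ b₁ … bₘ)(e₁ a₁ … aₙ)
-- under the n+m binders, aᵢ (i = 0..n-1) has index m+(n-1-i),
-- bⱼ (j = 0..m-1) has index m-1-j; e₁, e₂ are shifted so that the
-- new variables are fresh for them.
cutTerm : ℕ → ℕ → PT → PT → PT
cutTerm n m e₁ e₂ =
  lams (n + m)
    (app (apps (shift 0 (n + m) e₂) (map (λ j → pv (m ∸ suc j)) (upTo m)))
         (apps (shift 0 (n + m) e₁) (map (λ i → pv (m + (n ∸ suc i))) (upTo n))))

data _⊢_∶_ {Fn : Set} (Φ : Program Fn) : PT → Horn Fn → Set where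
  axiom : ∀ {κ As B} → (κ ∶ As ⇒ B) ∈ Φ → Φ ⊢ con κ ∶ ⟨ true ∣ As ⇒ B ⟩
  gen   : ∀ {e As B} → Φ ⊢ e ∶ ⟨ false ∣ As ⇒ B ⟩ → Φ ⊢ e ∶ ⟨ true ∣ As ⇒ B ⟩
  inst  : ∀ {e As B} (σ : ℕ → Term Fn) → Φ ⊢ e ∶ ⟨ true ∣ As ⇒ B ⟩ →
          Φ ⊢ e ∶ ⟨ false ∣ map (substA σ) As ⇒ substA σ B ⟩
  cut   : ∀ {e₁ e₂ As Bs D C} →
          Φ ⊢ e₁ ∶ ⟨ false ∣ As ⇒ D ⟩ → Φ ⊢ e₂ ∶ ⟨ false ∣ Bs ∷ʳ D ⇒ C ⟩ →
          Φ ⊢ cutTerm (length As) (length Bs) e₁ e₂ ∶ ⟨ false ∣ As ++ Bs ⇒ C ⟩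

-- extended signature: the old symbols plus a new symbol f_κ for each κ
Ext : Set → Set
Ext Fn = Fn ⊎ ℕ

fκ : ∀ {Fn} → ℕ → List (Term (Ext Fn)) → Term (Ext Fn)
fκ κ ts = fn (inj₂ κ) ts

_[_] : ∀ {Fn} → Atom Fn → Term Fn → Atom Fn
atom P ts [ t ] = atom P (ts ∷ʳ t)

nth : ∀ {A : Set} → List A → ℕ → Maybe A
nth []       n       = nothing
nth (x ∷ xs) zero    = just x
nth (x ∷ xs) (suc n) = nth xs n

-- ⟦_⟧_φ on first-order normal proof terms (undefined = nothing otherwise)
mutual
  rep : ∀ {Fn} → (ℕ → Maybe (Term (Ext Fn))) → PT → Maybe (Term (Ext Fn))
  rep φ (pv x)    = φ x
  rep φ (con k)   = spine φ (con k) >>= λ { (κ , ts) → just (fκ κ ts) }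
  rep φ (app e f) = spine φ (app e f) >>= λ { (κ , ts) → just (fκ κ ts) }
  rep φ (lam e)   = nothing

  spine : ∀ {Fn} → (ℕ → Maybe (Term (Ext Fn))) → PT → Maybe (ℕ × List (Term (Ext Fn)))
  spine φ (con k)   = just (k , [])
  spine φ (app e f) = spine φ e >>= λ { (κ , ts) → rep φ f >>= λ t → just (κ , ts ∷ʳ t) }
  spine φ (pv x)    = nothing
  spine φ (lam e)   = nothing

-- [y̲/a̲] for e = λa₁…λaₘ.n : under the m binders aᵢ has de Bruijn index m-i,
-- so index x is mapped to the (x+1)-th element of reverse y̲.
ysMap : ∀ {Fn} → List ℕ → ℕ → Maybe (Term (Ext Fn))
ysMap ys x = nth (reverse ys) x >>= λ y → just (var y)

strip : ℕ → PT → Maybe PT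
strip zero    e       = just e
strip (suc m) (lam e) = strip m e
strip (suc m) _       = nothing

hypsY : ∀ {Fn} → List (Atom Fn) → List ℕ → List (Atom (Ext Fn))
hypsY As ys = zipWith (λ A y → mapA inj₁ A [ var y ]) As ys

-- F(e : [∀x̲]. A̲ ⇒ B) with the fresh variables y̲ given explicitly;
-- the quantifier flag is kept ([∀x̲] ↦ [∀x̲.∀y̲]).
FJ : ∀ {Fn} → PT → Horn Fn → List ℕ → Maybe (Horn (Ext Fn))
FJ (con κ) ⟨ q ∣ As ⇒ B ⟩ ys =
  just ⟨ q ∣ hypsY As ys ⇒ mapA inj₁ B [ fκ κ (map var ys) ] ⟩
FJ e ⟨ q ∣ As ⇒ B ⟩ ys =
  strip (length As) e >>= λ n →
  rep (ysMap ys) n >>= λ t →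
  just ⟨ q ∣ hypsY As ys ⇒ mapA inj₁ B [ t ] ⟩

-- canonical fresh variables for a clause: N, N+1, …, N+m-1 with N above all
-- variables of the clause
freshYs : ∀ {Fn} → List (Atom Fn) → Atom Fn → List ℕ
freshYs As B = map (λ i → suc (foldr _⊔_ 0 (varsH As B)) + i) (upTo (length As))

FClause : ∀ {Fn} → Clause Fn → Clause (Ext Fn)
FClause (κ ∶ As ⇒ B) =
  κ ∶ hypsY As (freshYs As B) ⇒ (mapA inj₁ B [ fκ κ (map var (freshYs As B)) ])

FProg : ∀ {Fn} → Program Fn → Program (Ext Fn)
FProg Φ = map FClause Φ

module Submission where

-- Induction on the typing derivation, carrying for every list ys of the right length the term t
-- that F puts into the head and a derivation of the transformed judgement.  For an axiom this
-- is the clause of F(Φ) renamed from its canonical fresh variables to ys; for inst σ it is the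
-- induction hypothesis at the canonical fresh variables, instantiated by σ together with the
-- renaming of those variables to ys.  In a normal cut λa̲.λb̲.(e₂ b̲)(e₁ a̲) the proof e₂ must be
-- a constant κ, since a λ-abstraction in head position would create a β-redex, and for the same
-- reason e₁ is a constant unless a̲ is empty.  Hence the cut is represented by f_κ(y̲_B, t₁),
-- where t₁ represents e₁ a̲, and the transformed judgement is the cut of the one for e₁ with the
-- one for κ whose last fresh variable is instantiated to t₁.

open import Defs
open import Data.Bool using (Bool; false; true)
open import Data.Empty using (⊥-elim)
open import Data.List using (List; applyUpTo; []; _∷_; _++_; _∷ʳ_; map; length; reverse; upTo; zipWith; foldr; concatMap)
open import Data.List.Properties using (length-map; length-upTo; length-reverse; length-++; length-zipWith; map-cong; map-cong-local; map-id; map-upTo; reverse-++; unfold-reverse; ++-assoc; ++-identityʳ)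
open import Data.List.Membership.Propositional using (_∈_; _∉_)
open import Data.List.Membership.Propositional.Properties using (∈-map⁻; ∈-map⁺; ∈-++⁺ˡ; ∈-++⁺ʳ)
open import Data.List.Relation.Binary.Pointwise as Pointwise using (Pointwise; []; _∷_)
open import Data.List.Relation.Unary.All as All using (All)
open import Data.List.Relation.Unary.Any using (here; there)
open import Data.List.Relation.Unary.AllPairs using (_∷_)
open import Data.List.Relation.Unary.Unique.Propositional using (Unique)
import Data.List.Relation.Unary.Unique.Propositional.Properties as Unique
open import Data.Maybe using (Maybe; just; nothing; _>>=_)
open import Data.Nat using (ℕ; zero; suc; _+_; _∸_; _⊔_; _⊓_; _≤_; s≤s)
open import Data.Nat.Properties using (_≟_; m≤m⊔n; m≤n⊔m; m≤m+n; ≤-trans; <⇒≢; +-cancelˡ-≡; +-identityʳ; +-comm; suc-injective; ⊓-idem)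
open import Data.Product using (∃; _×_; _,_; proj₂)
open import Data.Sum using (_⊎_; inj₁; inj₂)
open import Function using (_∘_)
open import Relation.Nullary using (¬_; yes; no)
open import Relation.Binary.PropositionalEquality using (_≡_; _≢_; refl; sym; trans; cong; cong₂; subst; subst₂; module ≡-Reasoning)

nth-++ʳ : ∀ {A : Set} (xs ys : List A) k → nth (xs ++ ys) (length xs + k) ≡ nth ys k
nth-++ʳ []       ys k = refl
nth-++ʳ (x ∷ xs) ys k = nth-++ʳ xs ys k

Pointwise-nth : ∀ {A B : Set} {R : A → B → Set} {xs ys} → Pointwise R xs ys →
  ∀ k {x} → nth xs k ≡ just x → ∃ λ y → nth ys k ≡ just y × R x y
Pointwise-nth (r ∷ rs) zero    refl = _ , refl , r
Pointwise-nth (r ∷ rs) (suc k) eq   = Pointwise-nth rs k eq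

Pointwise-map⁺ˡ : ∀ {A B C : Set} {R : A → B → Set} (f : C → A) {xs ys} →
  Pointwise (R ∘ f) xs ys → Pointwise R (map f xs) ys
Pointwise-map⁺ˡ f []       = []
Pointwise-map⁺ˡ f (r ∷ rs) = r ∷ Pointwise-map⁺ˡ f rs

reverse-∷-++ : ∀ {A : Set} (x : A) xs ys → reverse (x ∷ xs) ++ ys ≡ reverse xs ++ x ∷ ys
reverse-∷-++ x xs ys = trans (cong (_++ ys) (unfold-reverse x xs)) (++-assoc (reverse xs) (x ∷ []) ys)

-- Under the binders of λx₁…λxₖ the de Bruijn index of xⱼ₊₁ is k ∸ suc j.
nth-reverse-upTo : ∀ {A : Set} (xs ys : List A) →
  Pointwise (λ j x → nth (reverse xs ++ ys) (length xs ∸ suc j) ≡ just x) (upTo (length xs)) xs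
nth-reverse-upTo []       ys = []
nth-reverse-upTo {A} (x ∷ xs) ys rewrite reverse-∷-++ x xs ys = first ∷ rest
  where
  R : ℕ → A → Set
  R j y = nth (reverse xs ++ x ∷ ys) (length xs ∸ j) ≡ just y
  first : nth (reverse xs ++ x ∷ ys) (length xs) ≡ just x
  first = subst (λ k → nth (reverse xs ++ x ∷ ys) k ≡ just x)
            (trans (+-identityʳ _) (length-reverse xs)) (nth-++ʳ (reverse xs) (x ∷ ys) 0)
  rest : Pointwise R (applyUpTo suc (length xs)) xs
  rest = subst (λ is → Pointwise R is xs) (map-upTo suc (length xs))
           (Pointwise-map⁺ˡ suc (nth-reverse-upTo xs (x ∷ ys)))

++-split : ∀ {A : Set} n {m} (zs : List A) → length zs ≡ n + m →
  ∃ λ xs → ∃ λ ys → zs ≡ xs ++ ys × length xs ≡ n × length ys ≡ m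
++-split zero    zs       len = [] , zs , refl , refl , len
++-split (suc n) (z ∷ zs) len with ++-split n zs (suc-injective len)
... | xs , ys , refl , lxs , lys = z ∷ xs , ys , refl , cong suc lxs , lys

≤-foldr-⊔ : ∀ {x} xs → x ∈ xs → x ≤ foldr _⊔_ 0 xs
≤-foldr-⊔ (y ∷ xs) (here refl) = m≤m⊔n y _
≤-foldr-⊔ (y ∷ xs) (there x∈) = ≤-trans (≤-foldr-⊔ xs x∈) (m≤n⊔m y _)

module _ {Fn : Set} (As : List (Atom Fn)) (B : Atom Fn) where

  length-freshYs : length (freshYs As B) ≡ length As
  length-freshYs = trans (length-map _ (upTo (length As))) (length-upTo (length As))

  freshYs-unique : Unique (freshYs As B)
  freshYs-unique = Unique.map⁺ (+-cancelˡ-≡ _ _ _) (Unique.upTo⁺ (length As))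

  freshYs-fresh : ∀ {x} → x ∈ varsH As B → x ∉ freshYs As B
  freshYs-fresh {x} x∈ x∈ys with ∈-map⁻ _ x∈ys
  ... | i , _ , refl = <⇒≢ (s≤s (≤-trans (≤-foldr-⊔ (varsH As B) x∈) (m≤m+n _ i))) refl

module _ {G : Set} where

  mutual
    substT-var : (t : Term G) → substT var t ≡ t
    substT-var (var x)   = refl
    substT-var (fn f ts) = cong (fn f) (substTs-var ts)

    substTs-var : (ts : List (Term G)) → substTs var ts ≡ ts
    substTs-var []       = refl
    substTs-var (t ∷ ts) = cong₂ _∷_ (substT-var t) (substTs-var ts)

  substA-var : (A : Atom G) → substA var A ≡ A
  substA-var (atom P ts) = cong (atom P) (substTs-var ts)

  map-substA-var : (As : List (Atom G)) → map (substA var) As ≡ As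
  map-substA-var As = trans (map-cong substA-var As) (map-id As)

  substTs-∷ʳ : (τ : ℕ → Term G) (ts : List (Term G)) (t : Term G) →
    substTs τ (ts ∷ʳ t) ≡ substTs τ ts ∷ʳ substT τ t
  substTs-∷ʳ τ []       t = refl
  substTs-∷ʳ τ (u ∷ ts) t = cong (substT τ u ∷_) (substTs-∷ʳ τ ts t)

  substTs-map-var : (τ : ℕ → Term G) (xs : List ℕ) → substTs τ (map var xs) ≡ map τ xs
  substTs-map-var τ []       = refl
  substTs-map-var τ (x ∷ xs) = cong (τ x ∷_) (substTs-map-var τ xs)

  assign : List ℕ → List (Term G) → (ℕ → Term G) → ℕ → Term G
  assign (z ∷ zs) (u ∷ us) ρ x with x ≟ z
  ... | yes _ = u
  ... | no  _ = assign zs us ρ x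
  assign _ _ ρ x = ρ x

  assign-∉ : ∀ {zs us ρ x} → x ∉ zs → assign zs us ρ x ≡ ρ x
  assign-∉ {[]}                 _  = refl
  assign-∉ {z ∷ zs} {[]}        _  = refl
  assign-∉ {z ∷ zs} {u ∷ us} {x = x} x∉ with x ≟ z
  ... | yes x≡z = ⊥-elim (x∉ (here x≡z))
  ... | no  _   = assign-∉ (x∉ ∘ there)

  map-assign : ∀ {zs us} ρ → Unique zs → length zs ≡ length us → map (assign zs us ρ) zs ≡ us
  map-assign {[]}     {[]}     ρ _           _   = refl
  map-assign {z ∷ zs} {u ∷ us} ρ (z∉ ∷ uniq) len =
    cong₂ _∷_ hit (trans (map-cong-local (All.map skip z∉)) (map-assign ρ uniq (suc-injective len)))
    where
    hit : assign (z ∷ zs) (u ∷ us) ρ z ≡ u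
    hit with z ≟ z
    ... | yes _   = refl
    ... | no  z≢z = ⊥-elim (z≢z refl)
    skip : ∀ {x} → z ≢ x → assign (z ∷ zs) (u ∷ us) ρ x ≡ assign zs us ρ x
    skip {x} z≢x with x ≟ z
    ... | yes x≡z = ⊥-elim (z≢x (sym x≡z))
    ... | no  _   = refl

module _ {Fn : Set} where

  Agree : (ℕ → Term (Ext Fn)) → (ℕ → Term Fn) → List ℕ → Set
  Agree τ σ xs = ∀ {x} → x ∈ xs → τ x ≡ mapT inj₁ (σ x)

  mutual
    substT-mapT : ∀ τ σ (t : Term Fn) → Agree τ σ (varsT t) →
      substT τ (mapT inj₁ t) ≡ mapT inj₁ (substT σ t)
    substT-mapT τ σ (var x)   agree = agree (here refl)
    substT-mapT τ σ (fn f ts) agree = cong (fn (inj₁ f)) (substTs-mapTs τ σ ts agree)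

    substTs-mapTs : ∀ τ σ (ts : List (Term Fn)) → Agree τ σ (varsTs ts) →
      substTs τ (mapTs inj₁ ts) ≡ mapTs inj₁ (substTs σ ts)
    substTs-mapTs τ σ []       agree = refl
    substTs-mapTs τ σ (t ∷ ts) agree = cong₂ _∷_ (substT-mapT τ σ t (agree ∘ ∈-++⁺ˡ))
                                                 (substTs-mapTs τ σ ts (agree ∘ ∈-++⁺ʳ (varsT t)))

  substA-[] : ∀ τ σ (A : Atom Fn) u → Agree τ σ (varsA A) →
    substA τ (mapA inj₁ A [ u ]) ≡ mapA inj₁ (substA σ A) [ substT τ u ]
  substA-[] τ σ (atom P ts) u agree = cong (atom P)
    (trans (substTs-∷ʳ τ (mapTs inj₁ ts) u) (cong (_∷ʳ substT τ u) (substTs-mapTs τ σ ts agree)))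

  hypsT : List (Atom Fn) → List (Term (Ext Fn)) → List (Atom (Ext Fn))
  hypsT = zipWith (λ A u → mapA inj₁ A [ u ])

  hypsT-map-var : ∀ As ys → hypsT As (map var ys) ≡ hypsY As ys
  hypsT-map-var []       ys       = refl
  hypsT-map-var (A ∷ As) []       = refl
  hypsT-map-var (A ∷ As) (y ∷ ys) = cong (_ ∷_) (hypsT-map-var As ys)

  hypsT-++ : ∀ As {As′} us {us′} → length us ≡ length As →
    hypsT (As ++ As′) (us ++ us′) ≡ hypsT As us ++ hypsT As′ us′
  hypsT-++ []       []       _   = refl
  hypsT-++ (A ∷ As) (u ∷ us) len = cong (_ ∷_) (hypsT-++ As us (suc-injective len))

  hypsY-++ : ∀ (As : List (Atom Fn)) {As′} ys {ys′} → length ys ≡ length As →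
    hypsY (As ++ As′) (ys ++ ys′) ≡ hypsY As ys ++ hypsY As′ ys′
  hypsY-++ []       []       _   = refl
  hypsY-++ (A ∷ As) (y ∷ ys) len = cong (_ ∷_) (hypsY-++ As ys (suc-injective len))

  length-hypsY : ∀ (As : List (Atom Fn)) ys → length ys ≡ length As → length (hypsY As ys) ≡ length As
  length-hypsY As ys len = trans (length-zipWith _ As ys) (trans (cong (length As ⊓_) len) (⊓-idem (length As)))

  map-substA-hypsY : ∀ τ σ As zs → Agree τ σ (concatMap varsA As) →
    map (substA τ) (hypsY As zs) ≡ hypsT (map (substA σ) As) (map τ zs)
  map-substA-hypsY τ σ []       zs       agree = refl
  map-substA-hypsY τ σ (A ∷ As) []       agree = refl
  map-substA-hypsY τ σ (A ∷ As) (z ∷ zs) agree = cong₂ _∷_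
    (substA-[] τ σ A (var z) (agree ∘ ∈-++⁺ˡ)) (map-substA-hypsY τ σ As zs (agree ∘ ∈-++⁺ʳ (varsA A)))

module _ {Fn : Set} {Ψ : Program (Ext Fn)} where

  ⊢-subst : ∀ {e q Hs H} (τ : ℕ → Term (Ext Fn)) → Ψ ⊢ e ∶ ⟨ q ∣ Hs ⇒ H ⟩ →
    Ψ ⊢ e ∶ ⟨ false ∣ map (substA τ) Hs ⇒ substA τ H ⟩
  ⊢-subst {q = true}  τ d = inst τ d
  ⊢-subst {q = false} τ d = inst τ (gen d)

  ⊢-assign : ∀ {e q As B zs us t} (σ : ℕ → Term Fn) → Unique zs → length zs ≡ length us →
    (∀ {x} → x ∈ varsH As B → x ∉ zs) →
    Ψ ⊢ e ∶ ⟨ q ∣ hypsY As zs ⇒ mapA inj₁ B [ t ] ⟩ →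
    Ψ ⊢ e ∶ ⟨ false ∣ hypsT (map (substA σ) As) us ⇒
                      mapA inj₁ (substA σ B) [ substT (assign zs us (mapT inj₁ ∘ σ)) t ] ⟩
  ⊢-assign {e = e} {As = As} {B} {zs} {us} {t} σ uniq len fresh d =
    subst₂ (λ Hs H → Ψ ⊢ e ∶ ⟨ false ∣ Hs ⇒ H ⟩)
      (trans (map-substA-hypsY τ σ As zs (assign-∉ ∘ fresh ∘ ∈-++⁺ˡ))
             (cong (hypsT (map (substA σ) As)) (map-assign _ uniq len)))
      (substA-[] τ σ B t (assign-∉ ∘ fresh ∘ ∈-++⁺ʳ (concatMap varsA As)))
      (⊢-subst τ d)
    where
    τ : ℕ → Term (Ext Fn)
    τ = assign zs us (mapT inj₁ ∘ σ)

  ⊢-instantiate-fresh : ∀ {e q} {Bs : List (Atom Fn)} {D C κ ysB t} → length ysB ≡ length Bs →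
    Ψ ⊢ e ∶ ⟨ q ∣ hypsY (Bs ∷ʳ D) (freshYs (Bs ∷ʳ D) C) ⇒ mapA inj₁ C [ fκ κ (map var (freshYs (Bs ∷ʳ D) C)) ] ⟩ →
    Ψ ⊢ e ∶ ⟨ false ∣ hypsY Bs ysB ∷ʳ mapA inj₁ D [ t ] ⇒ mapA inj₁ C [ fκ κ (map var ysB ∷ʳ t) ] ⟩
  ⊢-instantiate-fresh {e} {q} {Bs} {D} {C} {κ} {ysB} {t} lB d =
    subst₂ (λ Hs H → Ψ ⊢ e ∶ ⟨ false ∣ Hs ⇒ H ⟩)
      (trans (cong (λ Xs → hypsT Xs us) (map-substA-var (Bs ∷ʳ D)))
        (trans (hypsT-++ Bs (map var ysB) lBs) (cong (_∷ʳ _) (hypsT-map-var Bs ysB))))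
      (cong₂ (λ C′ u → mapA inj₁ C′ [ u ]) (substA-var C)
        (cong (fn (inj₂ κ)) (trans (substTs-map-var θ zs) (map-assign _ (freshYs-unique (Bs ∷ʳ D) C) lenzs))))
      (⊢-assign var (freshYs-unique (Bs ∷ʳ D) C) lenzs (freshYs-fresh (Bs ∷ʳ D) C) d)
    where
    us : List (Term (Ext Fn))
    us = map var ysB ∷ʳ t
    zs : List ℕ
    zs = freshYs (Bs ∷ʳ D) C
    lBs : length (map var ysB) ≡ length Bs
    lBs = trans (length-map var ysB) lB
    lenzs : length zs ≡ length us
    lenzs = trans (length-freshYs (Bs ∷ʳ D) C)
              (trans (length-++ Bs) (sym (trans (length-++ (map var ysB)) (cong (_+ 1) lBs))))
    θ : ℕ → Term (Ext Fn)
    θ = assign zs us (mapT inj₁ ∘ var)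

  ⊢-cut-hypsY : ∀ {e₁ e₂} {As Bs : List (Atom Fn)} {ysA ysB D C} →
    length ysA ≡ length As → length ysB ≡ length Bs →
    Ψ ⊢ e₁ ∶ ⟨ false ∣ hypsY As ysA ⇒ D ⟩ → Ψ ⊢ e₂ ∶ ⟨ false ∣ hypsY Bs ysB ∷ʳ D ⇒ C ⟩ →
    Ψ ⊢ cutTerm (length As) (length Bs) e₁ e₂ ∶ ⟨ false ∣ hypsY (As ++ Bs) (ysA ++ ysB) ⇒ C ⟩
  ⊢-cut-hypsY {e₁} {e₂} {As} {Bs} {ysA} {ysB} {C = C} lA lB d₁ d₂ =
    subst (λ Hs → Ψ ⊢ cutTerm (length As) (length Bs) e₁ e₂ ∶ ⟨ false ∣ Hs ⇒ C ⟩)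
      (sym (hypsY-++ As {Bs} ysA {ysB} lA))
      (subst₂ (λ n m → Ψ ⊢ cutTerm n m e₁ e₂ ∶ ⟨ false ∣ hypsY As ysA ++ hypsY Bs ysB ⇒ C ⟩)
        (length-hypsY As ysA lA) (length-hypsY Bs ysB lB) (cut {As = hypsY As ysA} {Bs = hypsY Bs ysB} d₁ d₂))

Normal-lams : ∀ k {e} → Normal (lams k e) → Normal e
Normal-lams zero    nf = nf
Normal-lams (suc k) nf = Normal-lams k (λ e′ r → nf (lam e′) (ξlam r))

Normal-appˡ : ∀ {e f} → Normal (app e f) → Normal e
Normal-appˡ nf e′ r = nf _ (ξl r)

Normal-appʳ : ∀ {e f} → Normal (app e f) → Normal f
Normal-appʳ nf f′ r = nf _ (ξr r)

Normal-apps : ∀ {e} ps → Normal (apps e ps) → Normal e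
Normal-apps []       nf = nf
Normal-apps (p ∷ ps) nf = Normal-appˡ (Normal-apps ps nf)

shift-reduces : ∀ c d {e e′} → e ⟶β e′ → ∃ λ e″ → shift c d e ⟶β e″
shift-reduces c d β        = _ , β
shift-reduces c d (ξlam r) = _ , ξlam (proj₂ (shift-reduces (suc c) d r))
shift-reduces c d (ξl r)   = _ , ξl (proj₂ (shift-reduces c d r))
shift-reduces c d (ξr r)   = _ , ξr (proj₂ (shift-reduces c d r))

Normal-shift : ∀ c d {e} → Normal (shift c d e) → Normal e
Normal-shift c d nf e′ r = nf _ (proj₂ (shift-reduces c d r))

¬Normal-apps-lam : ∀ {e p} ps → ¬ Normal (apps (lam e) (p ∷ ps))
¬Normal-apps-lam ps nf = Normal-apps ps nf _ β

¬Normal-app-apps-lam : ∀ {e q} ps → ¬ Normal (app (apps (lam e) ps) q)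
¬Normal-app-apps-lam []       nf = nf _ β
¬Normal-app-apps-lam (p ∷ ps) nf = ¬Normal-apps-lam ps (Normal-appˡ nf)

lams-suc : ∀ {n k} e → n ≡ suc k → ∃ λ b → lams n e ≡ lam b
lams-suc e refl = _ , refl

con-or-lam : ∀ {Fn} {Φ : Program Fn} {e q As B k} → Φ ⊢ e ∶ ⟨ q ∣ As ⇒ B ⟩ → length As ≡ suc k →
  (∃ λ κ → e ≡ con κ) ⊎ (∃ λ b → e ≡ lam b)
con-or-lam (axiom _)                _   = inj₁ (_ , refl)
con-or-lam (gen d)                  len = con-or-lam d len
con-or-lam (inst {As = As} σ d)     len = con-or-lam d (trans (sym (length-map (substA σ) As)) len)
con-or-lam (cut {As = As} {Bs} _ _) len = inj₂ (lams-suc _ (trans (sym (length-++ As)) len))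

module _ {Fn : Set} where

  Env : Set
  Env = ℕ → Maybe (Term (Ext Fn))

  RepresentsAll : Env → List PT → List (Term (Ext Fn)) → Set
  RepresentsAll φ = Pointwise (λ p u → rep φ p ≡ just u)

  mutual
    rep-subst : ∀ (θ : ℕ → Term (Ext Fn)) {φ ψ : Env} → (∀ {x u} → φ x ≡ just u → ψ x ≡ just (substT θ u)) →
      ∀ e {t} → rep φ e ≡ just t → rep ψ e ≡ just (substT θ t)
    rep-subst θ h (pv x)    eq   = h eq
    rep-subst θ h (con k)   refl = refl
    rep-subst θ {φ} h (app e f) eq with spine φ e in eqₑ
    ... | just (κ , ts) with rep φ f in eqf
    rep-subst θ h (app e f) refl | just (κ , ts) | just u
      rewrite spine-subst θ h e eqₑ | rep-subst θ h f eqf = cong (just ∘ fκ κ) (sym (substTs-∷ʳ θ ts u))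

    spine-subst : ∀ (θ : ℕ → Term (Ext Fn)) {φ ψ : Env} → (∀ {x u} → φ x ≡ just u → ψ x ≡ just (substT θ u)) →
      ∀ e {κ ts} → spine φ e ≡ just (κ , ts) → spine ψ e ≡ just (κ , substTs θ ts)
    spine-subst θ h (con k)   refl = refl
    spine-subst θ {φ} h (app e f) eq with spine φ e in eqₑ
    ... | just (κ , ts) with rep φ f in eqf
    spine-subst θ h (app e f) refl | just (κ , ts) | just u
      rewrite spine-subst θ h e eqₑ | rep-subst θ h f eqf = cong (λ us → just (κ , us)) (sym (substTs-∷ʳ θ ts u))

  mutual
    rep-shift : (φ : Env) (d : ℕ) (e : PT) → rep φ (shift 0 d e) ≡ rep (λ x → φ (x + d)) e
    rep-shift φ d (pv x)    = refl
    rep-shift φ d (con k)   = refl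
    rep-shift φ d (lam e)   = refl
    rep-shift φ d (app e f) rewrite spine-shift φ d e with spine (λ x → φ (x + d)) e
    ... | nothing       = refl
    ... | just (κ , ts) rewrite rep-shift φ d f = refl

    spine-shift : (φ : Env) (d : ℕ) (e : PT) → spine φ (shift 0 d e) ≡ spine (λ x → φ (x + d)) e
    spine-shift φ d (pv x)    = refl
    spine-shift φ d (con k)   = refl
    spine-shift φ d (lam e)   = refl
    spine-shift φ d (app e f) rewrite spine-shift φ d e with spine (λ x → φ (x + d)) e
    ... | nothing       = refl
    ... | just (κ , ts) rewrite rep-shift φ d f = refl

  spine-apps : ∀ {φ : Env} e {κ ts ps us} → spine φ e ≡ just (κ , ts) →
    RepresentsAll φ ps us → spine φ (apps e ps) ≡ just (κ , ts ++ us)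
  spine-apps e {ts = ts} eq [] = trans eq (cong (λ us → just (_ , us)) (sym (++-identityʳ ts)))
  spine-apps {φ} e {κ} {ts} {p ∷ ps} {u ∷ us} eq (r ∷ rs) =
    trans (spine-apps (app e p) step rs) (cong (λ vs → just (κ , vs)) (++-assoc ts (u ∷ []) us))
    where
    step : spine φ (app e p) ≡ just (κ , ts ∷ʳ u)
    step rewrite eq | r = refl

  rep-spine : ∀ {φ : Env} e {κ us} → spine φ e ≡ just (κ , us) → rep φ e ≡ just (fκ κ us)
  rep-spine (con k) refl = refl
  rep-spine {φ} (app e f) eq with spine φ e
  ... | just (κ , ts) with rep φ f
  rep-spine (app e f) refl | just (κ , ts) | just u = refl

strip-lams : ∀ k e → strip k (lams k e) ≡ just e
strip-lams zero    e = refl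
strip-lams (suc k) e = strip-lams k e

module _ {Fn : Set} where

  -- the term that FJ e ⟨ q ∣ As ⇒ B ⟩ ys attaches to B, where n = length As
  realiser : PT → ℕ → List ℕ → Maybe (Term (Ext Fn))
  realiser (con κ) n ys = just (fκ κ (map var ys))
  realiser e       n ys = strip n e >>= rep (ysMap ys)

  FJ-realiser : ∀ e {q As B ys t} → realiser e (length As) ys ≡ just t →
    FJ e ⟨ q ∣ As ⇒ B ⟩ ys ≡ just ⟨ q ∣ hypsY As ys ⇒ mapA inj₁ B [ t ] ⟩
  FJ-realiser (con κ)             refl = refl
  FJ-realiser (pv x)    {As = As} eq with strip (length As) (pv x)
  ... | just b rewrite eq = refl
  FJ-realiser (lam e)   {As = As} eq with strip (length As) (lam e)
  ... | just b rewrite eq = refl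
  FJ-realiser (app e f) {As = As} eq with strip (length As) (app e f)
  ... | just b rewrite eq = refl

  realiser-zero : ∀ e → realiser e 0 [] ≡ rep (ysMap []) e
  realiser-zero (con κ)   = refl
  realiser-zero (pv x)    = refl
  realiser-zero (lam e)   = refl
  realiser-zero (app e f) = refl

  realiser-lams : ∀ k e f ys → realiser (lams k (app e f)) k ys ≡ rep (ysMap ys) (app e f)
  realiser-lams zero    e f ys = refl
  realiser-lams (suc k) e f ys rewrite strip-lams k (app e f) = refl

  module _ {τ : ℕ → Term (Ext Fn)} {zs ys : List ℕ} (τzs≡ys : map τ zs ≡ map var ys) where

    τzs≈ys : Pointwise (λ z y → τ z ≡ var y) zs ys
    τzs≈ys = Pointwise.map⁻ τ var (Pointwise.≡⇒Pointwise-≡ τzs≡ys)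

    ysMap-rename : ∀ {x u} → ysMap zs x ≡ just u → ysMap ys x ≡ just (substT τ u)
    ysMap-rename {x} eq with nth (reverse zs) x in hz
    ysMap-rename {x} refl | just z with Pointwise-nth (Pointwise.reverse⁺ τzs≈ys) x hz
    ... | y , hy , τz≡y rewrite hy | τz≡y = refl

    bind-rep-rename : ∀ m {t} → (m >>= rep (ysMap zs)) ≡ just t → (m >>= rep (ysMap ys)) ≡ just (substT τ t)
    bind-rep-rename (just b) = rep-subst τ ysMap-rename b

    realiser-rename : ∀ e n {t} → realiser e n zs ≡ just t → realiser e n ys ≡ just (substT τ t)
    realiser-rename (con κ)   n refl = cong (just ∘ fκ κ) (sym (trans (substTs-map-var τ zs) τzs≡ys))
    realiser-rename (pv x)    n = bind-rep-rename (strip n (pv x))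
    realiser-rename (lam e)   n = bind-rep-rename (strip n (lam e))
    realiser-rename (app e f) n = bind-rep-rename (strip n (app e f))

-- the arguments a̲ and b̲ of e₁ and e₂ in cutTerm n m e₁ e₂
aVars : ℕ → ℕ → List PT
aVars n m = map (λ i → pv (m + (n ∸ suc i))) (upTo n)

bVars : ℕ → List PT
bVars m = map (λ j → pv (m ∸ suc j)) (upTo m)

module _ {Fn : Set} where

  RepresentsAll-pvs : ∀ L (f : ℕ → ℕ) {is ys} → Pointwise (λ i y → nth (reverse L) (f i) ≡ just y) is ys →
    RepresentsAll {Fn} (ysMap L) (map (pv ∘ f) is) (map var ys)
  RepresentsAll-pvs L f rs = Pointwise.map⁺ (pv ∘ f) var (Pointwise.map (cong (_>>= λ y → just (var y))) rs)

  RepresentsAll-bVars : ∀ ysA ysB {m} → length ysB ≡ m →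
    RepresentsAll {Fn} (ysMap (ysA ++ ysB)) (bVars m) (map var ysB)
  RepresentsAll-bVars ysA ysB refl = RepresentsAll-pvs (ysA ++ ysB) _
    (subst (λ L → Pointwise (λ j y → nth L (length ysB ∸ suc j) ≡ just y) (upTo (length ysB)) ysB)
           (sym (reverse-++ ysA ysB)) (nth-reverse-upTo ysB (reverse ysA)))

  RepresentsAll-aVars : ∀ ysA ysB {n m} → length ysA ≡ n → length ysB ≡ m →
    RepresentsAll {Fn} (ysMap (ysA ++ ysB)) (aVars n m) (map var ysA)
  RepresentsAll-aVars ysA ysB refl refl =
    RepresentsAll-pvs (ysA ++ ysB) _ (Pointwise.map skip-ysB (nth-reverse-upTo ysA []))
    where
    open ≡-Reasoning
    skip-ysB : ∀ {k y} → nth (reverse ysA ++ []) k ≡ just y →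
      nth (reverse (ysA ++ ysB)) (length ysB + k) ≡ just y
    skip-ysB {k} {y} eq = begin
      nth (reverse (ysA ++ ysB)) (length ysB + k)
        ≡⟨ cong (λ L → nth L (length ysB + k)) (reverse-++ ysA ysB) ⟩
      nth (reverse ysB ++ reverse ysA) (length ysB + k)
        ≡⟨ cong (λ n → nth (reverse ysB ++ reverse ysA) (n + k)) (sym (length-reverse ysB)) ⟩
      nth (reverse ysB ++ reverse ysA) (length (reverse ysB) + k)
        ≡⟨ nth-++ʳ (reverse ysB) (reverse ysA) k ⟩
      nth (reverse ysA) k
        ≡⟨ cong (λ L → nth L k) (sym (++-identityʳ (reverse ysA))) ⟩
      nth (reverse ysA ++ []) k
        ≡⟨ eq ⟩
      just y
        ∎

  rep-cut-argument : ∀ {Φ : Program Fn} {e As D ysA ysB} {t : Term (Ext Fn)} m →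
    Φ ⊢ e ∶ ⟨ false ∣ As ⇒ D ⟩ → Normal (apps (shift 0 (length As + m) e) (aVars (length As) m)) →
    length ysA ≡ length As → length ysB ≡ m → realiser e (length As) ysA ≡ just t →
    rep (ysMap (ysA ++ ysB)) (apps (shift 0 (length As + m) e) (aVars (length As) m)) ≡ just t
  rep-cut-argument {e = e} {[]} {ysA = []} {ysB} {t} m _ _ _ refl r = begin
    rep (ysMap ysB) (shift 0 m e)   ≡⟨ rep-shift (ysMap ysB) m e ⟩
    rep (λ x → ysMap ysB (x + m)) e ≡⟨ rep-subst var (λ ()) e (trans (sym (realiser-zero e)) r) ⟩
    just (substT var t)             ≡⟨ cong just (substT-var t) ⟩
    just t                          ∎
    where open ≡-Reasoning
  rep-cut-argument {e = e} {A ∷ As} {ysA = ysA} {ysB} m d nf lA lB r with con-or-lam d refl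
  ... | inj₂ (b , refl) = ⊥-elim (¬Normal-apps-lam (map _ (applyUpTo suc (length As))) nf)
  ... | inj₁ (κ , refl) with refl ← r =
    rep-spine (apps (con κ) (aVars (length (A ∷ As)) m))
      (spine-apps (con κ) refl (RepresentsAll-aVars ysA ysB lA lB))

  realiser-cut : ∀ {Φ : Program Fn} {e As D ysA ysB} {t : Term (Ext Fn)} m κ →
    Φ ⊢ e ∶ ⟨ false ∣ As ⇒ D ⟩ → Normal (cutTerm (length As) m e (con κ)) →
    length ysA ≡ length As → length ysB ≡ m → realiser e (length As) ysA ≡ just t →
    realiser (cutTerm (length As) m e (con κ)) (length As + m) (ysA ++ ysB) ≡ just (fκ κ (map var ysB ∷ʳ t))
  realiser-cut {e = e} {As} {ysA = ysA} {ysB} {t} m κ d nf lA lB r =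
    trans (realiser-lams (n + m) (apps (con κ) (bVars m)) argument (ysA ++ ysB))
      (rep-spine (app (apps (con κ) (bVars m)) argument)
        (spine-apps (apps (con κ) (bVars m)) {ps = argument ∷ []}
          (spine-apps (con κ) refl (RepresentsAll-bVars ysA ysB lB))
          (rep-cut-argument {e = e} {As} {ysA = ysA} {ysB} m d
             (Normal-appʳ (Normal-lams (n + m) nf)) lA lB r ∷ [])))
    where
    n : ℕ
    n = length As
    argument : PT
    argument = apps (shift 0 (n + m) e) (aVars n m)

module _ {Fn : Set} {Φ : Program Fn} where

  Realised : PT → Horn Fn → List ℕ → Set
  Realised e ⟨ q ∣ As ⇒ B ⟩ ys =
    ∃ λ t → realiser e (length As) ys ≡ just t × FProg Φ ⊢ e ∶ ⟨ q ∣ hypsY As ys ⇒ mapA inj₁ B [ t ] ⟩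

  Realised-gen : ∀ {e As B ys} → Realised e ⟨ false ∣ As ⇒ B ⟩ ys → Realised e ⟨ true ∣ As ⇒ B ⟩ ys
  Realised-gen (t , r , d) = t , r , gen d

  axiom-realised : ∀ {κ As B} → (κ ∶ As ⇒ B) ∈ Φ → Realised (con κ) ⟨ true ∣ As ⇒ B ⟩ (freshYs As B)
  axiom-realised κ∈Φ = _ , refl , axiom (∈-map⁺ FClause κ∈Φ)

  Realised-inst : ∀ {e As B ys} σ → length ys ≡ length As →
    Realised e ⟨ true ∣ As ⇒ B ⟩ (freshYs As B) → Realised e ⟨ false ∣ map (substA σ) As ⇒ substA σ B ⟩ ys
  Realised-inst {e} {As} {B} {ys} σ len (t , r , d) =
    substT τ t ,
    subst (λ n → realiser e n ys ≡ just (substT τ t)) (sym (length-map (substA σ) As))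
      (realiser-rename τzs≡ys e _ r) ,
    subst (λ Hs → FProg Φ ⊢ e ∶ ⟨ false ∣ Hs ⇒ mapA inj₁ (substA σ B) [ substT τ t ] ⟩)
      (hypsT-map-var _ ys) (⊢-assign σ (freshYs-unique As B) lenzs (freshYs-fresh As B) d)
    where
    lenzs : length (freshYs As B) ≡ length (map var ys)
    lenzs = trans (length-freshYs As B) (sym (trans (length-map var ys) len))
    τ : ℕ → Term (Ext Fn)
    τ = assign (freshYs As B) (map var ys) (mapT inj₁ ∘ σ)
    τzs≡ys : map τ (freshYs As B) ≡ map var ys
    τzs≡ys = map-assign _ (freshYs-unique As B) lenzs

  Realised-cut : ∀ {e As D Bs C κ ysA ysB} → Φ ⊢ e ∶ ⟨ false ∣ As ⇒ D ⟩ →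
    Normal (cutTerm (length As) (length Bs) e (con κ)) → length ysA ≡ length As → length ysB ≡ length Bs →
    Realised e ⟨ false ∣ As ⇒ D ⟩ ysA → Realised (con κ) ⟨ false ∣ Bs ∷ʳ D ⇒ C ⟩ (freshYs (Bs ∷ʳ D) C) →
    Realised (cutTerm (length As) (length Bs) e (con κ)) ⟨ false ∣ As ++ Bs ⇒ C ⟩ (ysA ++ ysB)
  Realised-cut {e} {As} {D} {Bs} {C} {κ} {ysA} {ysB} d nf lA lB (t , r , d₁) (_ , refl , d₂) =
    fκ κ (map var ysB ∷ʳ t) ,
    subst (λ n → realiser (cutTerm (length As) (length Bs) e (con κ)) n (ysA ++ ysB) ≡ just _)
      (sym (length-++ As)) (realiser-cut (length Bs) κ d nf lA lB r) ,
    ⊢-cut-hypsY {As = As} {Bs} {ysA} {ysB} lA lB d₁ (⊢-instantiate-fresh lB d₂)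

  realised : ∀ {e q As B ys} → Φ ⊢ e ∶ ⟨ q ∣ As ⇒ B ⟩ → Normal e → length ys ≡ length As →
    Realised e ⟨ q ∣ As ⇒ B ⟩ ys
  realised (axiom {κ} {As} {B} κ∈Φ) _ len =
    Realised-gen (subst₂ (λ As′ B′ → Realised (con κ) ⟨ false ∣ As′ ⇒ B′ ⟩ _) (map-substA-var As) (substA-var B)
      (Realised-inst var len (axiom-realised κ∈Φ)))
  realised (gen d) nf len = Realised-gen (realised d nf len)
  realised (inst {As = As} {B} σ d) nf len =
    Realised-inst σ (trans len (length-map (substA σ) As)) (realised d nf (length-freshYs As B))
  realised {ys = ys} (cut {e₁} {As = As} {Bs} {D} {C} d₁ d₂) nf len
    with con-or-lam d₂ (trans (length-++ Bs) (+-comm (length Bs) 1))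
  ... | inj₂ (_ , refl) = ⊥-elim (¬Normal-app-apps-lam (bVars (length Bs)) (Normal-lams (length As + length Bs) nf))
  ... | inj₁ (κ , refl) with ++-split (length As) ys (trans len (length-++ As))
  ... | ysA , ysB , refl , lA , lB =
    Realised-cut {ysA = ysA} {ysB} d₁ nf lA lB
      (realised d₁ nf₁ lA) (realised d₂ (λ _ ()) (length-freshYs (Bs ∷ʳ D) C))
    where
    nf₁ : Normal e₁
    nf₁ = Normal-shift 0 _ (Normal-apps (aVars (length As) (length Bs))
            (Normal-appʳ (Normal-lams (length As + length Bs) nf)))

theorem4 : {Fn : Set} (Φ : Program Fn) → Unique (map label Φ) →
    (e : PT) (q : Bool) (As : List (Atom Fn)) (B : Atom Fn) →
    Φ ⊢ e ∶ ⟨ q ∣ As ⇒ B ⟩ → Normal e →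
    (ys : List ℕ) → length ys ≡ length As → Unique ys → All (λ y → y ∉ varsH As B) ys →
    ∃ λ G → FJ e ⟨ q ∣ As ⇒ B ⟩ ys ≡ just G × (FProg Φ ⊢ e ∶ G)
theorem4 Φ _ e q As B d nf ys len _ _ with realised d nf len
... | _ , r , d′ = _ , FJ-realiser e r , d′
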